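{- Let $\tau\ge1$ be an integer and $0<\kappa\le1$. Let $\mathcal P=(A_1,\dots,A_K;B_1,\dots,B_L)$ be a parade in a bigraph $G$. Then there is a contraction $\mathcal P'=(A_1',\dots,A_K';B_1',\dots,B_L')$ of $\mathcal P$ such that $|A_i'|\ge\kappa^{2^{K+L}\tau^\tau}|A_i|$ for $1\le i\le K$ and $|B_j'|\ge\kappa^{2^{K+L}\tau^\tau}|B_j|$ for $1\le j\le L$, and $\mathcal P'$ is $(\kappa,\tau)$-support-invariant.
   Context: A bigraph $G$ is a finite simple graph with a designated bipartition $(V_1(G),V_2(G))$, all edges between the parts; induced sub-bigraphs have parts $V_i(G)\cap X$; isomorphisms of bigraphs map $V_i$ onto $V_i$. A tree bigraph is a bigraph whose underlying graph is a tree. A parade in $G$ is a sequence $(A_1,\dots,A_K;B_1,\dots,B_L)$ of pairwise disjoint nonempty subsets of $V(G)$ with $A_i\subseteq V_1(G)$, $B_j\subseteq V_2(G)$, all $A_i$ of equal cardinality and all $B_j$ of equal cardinality (its blocks). A contraction is a parade $(A_1',\dots,A_K';B_1',\dots,B_L')$ with $A_i'\subseteq A_i$, $B_j'\subseteq B_j$. An induced sub-bigraph $H$ is $\mathcal P$-rainbow if each of its vertices lies in some block and no two lie in the same block; its support is $(I,J)$ with $I=\{i:V(H)\cap A_i\neq\emptyset\}$, $J=\{j:V(H)\cap B_j\ne\emptyset\}$. An ordered bigraph is a bigraph with linear orders on $V_1$ and $V_2$ (isomorphisms preserve them); a $\mathcal P$-rainbow $H$ is ordered by block index ($u<v$ if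 $u\in A_i,v\in A_j$ with $i<j$, similarly for the $B_j$), and is a $\mathcal P$-rainbow copy of an ordered bigraph $S$ if this ordered bigraph is isomorphic to $S$. The trace of $S$ relative to $\mathcal P$ is the set of supports of all $\mathcal P$-rainbow copies of $S$. For $0<\kappa\le1$ and integer $\tau$, $\mathcal P$ is $(\kappa,\tau)$-support-invariant if for every contraction $\mathcal P''=(A_1'',\dots;B_1'',\dots)$ of $\mathcal P$ with $|A_i''|\ge\kappa|A_i|$ and $|B_j''|\ge\kappa|B_j|$ for all $i,j$, and every ordered tree bigraph $S$ with at most $\tau$ vertices, the trace of $S$ relative to $\mathcal P''$ equals its trace relative to $\mathcal P$.
   Formalization: The parameter κ takes only rational values in $0<\kappa\le1$. -}

module Defs where

open import Data.Nat using (ℕ; zero; suc) renaming (_+_ to _+ℕ_; _*_ to _*ℕ_; _^_ to _^ℕ_; _≤_ to _≤ℕ_; _<_ to _<ℕ_)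
open import Data.Integer using (+_)
open import Data.Rational using (ℚ; _/_; _*_; _≤_; 1ℚ)
open import Data.Fin using (Fin)
open import Data.Fin.Subset using (Subset; _∈_; _⊆_; ∣_∣; Nonempty)
open import Data.Sum using (_⊎_; inj₁; inj₂)
open import Data.Product using (Σ; _×_; _,_; ∃; ∃-syntax)
open import Data.Bool using (Bool; true)
open import Data.List using (List; []; _∷_; length)
open import Data.List.Relation.Unary.Unique.Propositional using (Unique)
open import Data.List.Relation.Unary.Linked using (Linked)
open import Data.Empty using (⊥)
open import Relation.Nullary using (¬_)
open import Relation.Binary.PropositionalEquality using (_≡_; _≢_)
open import Function.Bundles using (_⇔_)

ℕ→ℚ : ℕ → ℚ
ℕ→ℚ n = + n / 1

_^ℚ_ : ℚ → ℕ → ℚ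
q ^ℚ zero  = 1ℚ
q ^ℚ suc n = q * (q ^ℚ n)

record Bigraph : Set where
  field
    n₁  : ℕ
    n₂  : ℕ
    adj : Fin n₁ → Fin n₂ → Bool
open Bigraph public

record Parade (G : Bigraph) (K L : ℕ) : Set where
  field
    A : Fin K → Subset (n₁ G)
    B : Fin L → Subset (n₂ G)
    A-nonempty : ∀ i → Nonempty (A i)
    B-nonempty : ∀ j → Nonempty (B j)
    A-disjoint : ∀ i i' → i ≢ i' → ∀ v → v ∈ A i → v ∈ A i' → ⊥
    B-disjoint : ∀ j j' → j ≢ j' → ∀ v → v ∈ B j → v ∈ B j' → ⊥
    A-equal    : ∀ i i' → ∣ A i ∣ ≡ ∣ A i' ∣
    B-equal    : ∀ j j' → ∣ B j ∣ ≡ ∣ B j' ∣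
open Parade public

IsContraction : ∀ {G K L} → Parade G K L → Parade G K L → Set
IsContraction P' P = (∀ i → A P' i ⊆ A P i) × (∀ j → B P' j ⊆ B P j)

-- Ordered bigraphs: parts Fin s₁, Fin s₂ with their natural orders.

record OrdBigraph : Set where
  field
    s₁   : ℕ
    s₂   : ℕ
    sadj : Fin s₁ → Fin s₂ → Bool
open OrdBigraph public

Vtx : OrdBigraph → Set
Vtx S = Fin (s₁ S) ⊎ Fin (s₂ S)

Adj : (S : OrdBigraph) → Vtx S → Vtx S → Set
Adj S (inj₁ x) (inj₂ y) = sadj S x y ≡ true
Adj S (inj₂ y) (inj₁ x) = sadj S x y ≡ true
Adj S (inj₁ _) (inj₁ _) = ⊥
Adj S (inj₂ _) (inj₂ _) = ⊥

record Path (S : OrdBigraph) (u v : Vtx S) : Set where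
  field
    verts    : List (Vtx S)
    first    : Σ (List (Vtx S)) λ rest → verts ≡ u ∷ rest
    last     : Σ (List (Vtx S)) λ init → verts ≡ init Data.List.++ (v ∷ [])
    distinct : Unique verts
    linked   : Linked (Adj S) verts

record Cycle (S : OrdBigraph) : Set where
  field
    v₁       : Vtx S
    rest     : List (Vtx S)
    vk       : Vtx S
    long     : 1 ≤ℕ length rest
    distinct : Unique (v₁ ∷ rest Data.List.++ (vk ∷ []))
    linked   : Linked (Adj S) (v₁ ∷ rest Data.List.++ (vk ∷ []))
    closing  : Adj S vk v₁

IsTree : OrdBigraph → Set
IsTree S = (1 ≤ℕ s₁ S +ℕ s₂ S)
         × (∀ u v → Path S u v)
         × ¬ Cycle S

StrictMono : ∀ {m n} → (Fin m → Fin n) → Set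
StrictMono f = ∀ x y → x Data.Fin.< y → f x Data.Fin.< f y

-- P-rainbow copies of an ordered bigraph S: an isomorphism of S onto an
-- induced P-rainbow sub-bigraph H of G, H ordered by block index.
-- Vertex x ∈ V₁(S) goes to f₁ x ∈ A (α x), y ∈ V₂(S) to f₂ y ∈ B (β y);
-- α, β strictly increasing (distinct blocks, order by block index
-- matches the order of S); adjacency is preserved and reflected.

record RainbowCopy {G K L} (P : Parade G K L) (S : OrdBigraph) : Set where
  field
    f₁ : Fin (s₁ S) → Fin (n₁ G)
    f₂ : Fin (s₂ S) → Fin (n₂ G)
    α  : Fin (s₁ S) → Fin K
    β  : Fin (s₂ S) → Fin L
    α-mono : StrictMono α
    β-mono : StrictMono β
    f₁∈ : ∀ x → f₁ x ∈ A P (α x)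
    f₂∈ : ∀ y → f₂ y ∈ B P (β y)
    edges : ∀ x y → adj G (f₁ x) (f₂ y) ≡ sadj S x y
open RainbowCopy public

HasSupport : ∀ {G K L} {P : Parade G K L} {S} → RainbowCopy P S
           → Subset K → Subset L → Set
HasSupport {K = K} {L} c I J =
  (∀ (i : Fin K) → (i ∈ I) ⇔ (∃[ x ] α c x ≡ i)) ×
  (∀ (j : Fin L) → (j ∈ J) ⇔ (∃[ y ] β c y ≡ j))

InTrace : ∀ {G K L} → Parade G K L → OrdBigraph → Subset K → Subset L → Set
InTrace P S I J = Σ (RainbowCopy P S) λ c → HasSupport c I J

SupportInvariant : ∀ {G K L} → ℚ → ℕ → Parade G K L → Set
SupportInvariant {G} {K} {L} κ τ P =
  (P'' : Parade G K L) → IsContraction P'' P →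
  (∀ i → κ * ℕ→ℚ ∣ A P i ∣ ≤ ℕ→ℚ ∣ A P'' i ∣) →
  (∀ j → κ * ℕ→ℚ ∣ B P j ∣ ≤ ℕ→ℚ ∣ B P'' j ∣) →
  (S : OrdBigraph) → IsTree S → s₁ S +ℕ s₂ S ≤ℕ τ →
  ∀ I J → InTrace P'' S I J ⇔ InTrace P S I J

-- A code (I , J , g) is a pair of supports together with a parent vector g : Fin τ → Fin τ; it is
-- alive in a parade when the bigraph whose edges are the pairs {k , g k} has a rainbow copy with
-- support (I , J).  Every ordered tree on at most τ vertices is such a bigraph: join each vertex
-- to the next vertex on its path to a fixed root, acyclicity ruling out any further edge.  A copy
-- with support (I , J) has part sizes ∣ I ∣ and ∣ J ∣, so the traces of trees are read off from the
-- alive codes, and aliveness is monotone under contraction.  Hence, while some κ-contraction kills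
-- an alive code, passing to it lowers the number of alive codes, which is at most 2^(K+L) τ^τ.
-- When no κ-contraction kills a code, the parade is (κ , τ)-support-invariant, and every step
-- has kept a κ-fraction of each block.

module Submission where

open import Defs
open import Level using (0ℓ)
open import Data.Nat using (ℕ; zero; suc; _^_; _≤?_; z≤n; s≤s; s<s⁻¹)
  renaming (_+_ to _+ℕ_; _*_ to _*ℕ_; _≤_ to _≤ℕ_; _<_ to _<ℕ_)
import Data.Nat.Properties as ℕ
open import Data.Rational using (ℚ; 0ℚ; 1ℚ; _<_; _≤_; _*_; NonNegative; nonNegative)
import Data.Rational.Properties as ℚ
open import Data.Bool using (Bool; true; false; T)
import Data.Bool.Properties as Bool
open import Data.Empty using (⊥-elim)
open import Data.Product using (Σ; _×_; _,_; ∃; ∃-syntax; proj₁; proj₂)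
open import Data.Sum using (_⊎_; inj₁; inj₂)
import Data.Sum.Properties as Sum
open import Data.Maybe using (fromMaybe)
open import Data.Fin as Fin using (Fin; zero; suc; inject≤; join; splitAt; punchOut)
import Data.Fin.Properties as Fin
open import Data.Fin.Properties using (any?; all?)
open import Data.Fin.Subset using (Subset; _∈_; _⊆_; ∣_∣; Nonempty; inside; outside)
open import Data.Fin.Subset.Properties using (_∈?_; _⊆?_; nonempty?; anySubset?; ⊆-antisym)
open import Data.Vec using (Vec; []; _∷_; lookup; tabulate; here; there)
open import Data.Vec.Properties using (lookup∘tabulate)
open import Data.List
  using (List; []; _∷_; _++_; [_]; _∷ʳ_; _ʳ++_; reverse; length; map; filter;
         cartesianProductWith; cartesianProduct; allFin)
open import Data.List.Properties
  using (++-assoc; reverse-++; unfold-reverse; length-++; length-map; length-filter; length-tabulate; ∷-injectiveˡ)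
open import Data.List.Membership.Propositional using (_∉_) renaming (_∈_ to _∈ˡ_)
open import Data.List.Membership.Propositional.Properties
  using (∈-∃++; ∈-++⁺ˡ; ∈-++⁺ʳ; ∈-++⁻; ∈-cartesianProductWith⁺; ∈-cartesianProduct⁺; ∈-allFin)
import Data.List.Relation.Unary.Any as Any
open import Data.List.Relation.Unary.Any.Properties using (reverse⁻)
open import Data.List.Relation.Unary.All as All using (All; []; _∷_)
import Data.List.Relation.Unary.All.Properties as All
open import Data.List.Relation.Unary.AllPairs as AllPairs using ([]; _∷_)
open import Data.List.Relation.Unary.Unique.Propositional using (Unique)
import Data.List.Relation.Unary.Unique.Propositional.Properties as Unique
open import Data.List.Relation.Unary.Linked as Linked using (Linked; []; [-]; _∷_)
open import Data.List.Relation.Binary.Disjoint.Propositional using (Disjoint)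
open import Data.List.Relation.Binary.Permutation.Propositional using (↭-sym; ↭⇒↭ₛ)
open import Data.List.Relation.Binary.Permutation.Propositional.Properties using (↭-reverse)
import Data.List.Relation.Binary.Permutation.Setoid.Properties as Permutation
open import Function using (_∘_)
open import Function.Bundles using (_⇔_; mk⇔; Equivalence)
open import Function.Definitions using (Injective)
import Function.Properties.Equivalence as ⇔
open import Relation.Unary using (Pred; Decidable)
open import Relation.Binary.Core using (Rel)
open import Relation.Binary.Definitions using (DecidableEquality; Symmetric)
open import Relation.Binary.PropositionalEquality
  using (_≡_; _≢_; _≗_; refl; sym; trans; cong; cong₂; subst; subst₂; module ≡-Reasoning)
open import Relation.Binary.PropositionalEquality.Properties using (setoid)
open import Relation.Nullary using (Dec; yes; no; ¬_; ¬?; does; proof)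
open import Relation.Nullary.Decidable using (map′; _×-dec_; _⊎-dec_; _→-dec_)
import Relation.Nullary.Reflects as Reflects

Searchable : Set → Set₁
Searchable A = ∀ {P : Pred A 0ℓ} → Decidable P → Dec (∃ P)

search-× : ∀ {A B} → Searchable A → Searchable B → Searchable (A × B)
search-× sA sB P? =
  map′ (λ (a , b , p) → (a , b) , p) (λ ((a , b) , p) → a , b , p)
       (sA λ a → sB λ b → P? (a , b))

search-⊎ : ∀ {A B} → Searchable A → Searchable B → Searchable (A ⊎ B)
search-⊎ sA sB P? =
  map′ (λ { (inj₁ (a , p)) → inj₁ a , p ; (inj₂ (b , p)) → inj₂ b , p })
       (λ { (inj₁ a , p) → inj₁ (a , p) ; (inj₂ b , p) → inj₂ (b , p) })
       (sA (P? ∘ inj₁) ⊎-dec sB (P? ∘ inj₂))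

search-Vec : ∀ {A} → Searchable A → ∀ n → Searchable (Vec A n)
search-Vec sA zero    P? = map′ ([] ,_) (λ { ([] , p) → p }) (P? [])
search-Vec sA (suc n) P? =
  map′ (λ (a , v , p) → a ∷ v , p) (λ { (a ∷ v , p) → a , v , p })
       (sA λ a → search-Vec sA n (P? ∘ (a ∷_)))

_⇔-dec_ : ∀ {A B : Set} → Dec A → Dec B → Dec (A ⇔ B)
a? ⇔-dec b? = map′ (λ (f , g) → mk⇔ f g) (λ e → Equivalence.to e , Equivalence.from e)
                   ((a? →-dec b?) ×-dec (b? →-dec a?))

Image : ∀ {s n} → (Fin s → Fin n) → Subset n → Set
Image {n = n} α I = ∀ (i : Fin n) → i ∈ I ⇔ (∃[ x ] α x ≡ i)

StrictMono-cong : ∀ {m n} {α α' : Fin m → Fin n} → α ≗ α' → StrictMono α → StrictMono α'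
StrictMono-cong α≗α' mono x y x<y = subst₂ Fin._<_ (α≗α' x) (α≗α' y) (mono x y x<y)

Image-cong : ∀ {s n} {α α' : Fin s → Fin n} {I} → α ≗ α' → Image α I → Image α' I
Image-cong α≗α' im i =
  mk⇔ (λ i∈I → let x , αx≡i = Equivalence.to (im i) i∈I in x , trans (sym (α≗α' x)) αx≡i)
      (λ (x , α'x≡i) → Equivalence.from (im i) (x , trans (α≗α' x) α'x≡i))

image? : ∀ {s n} (α : Fin s → Fin n) I → Dec (Image α I)
image? α I = all? λ i → (i ∈? I) ⇔-dec any? (λ x → α x Fin.≟ i)

strictMono? : ∀ {m n} (α : Fin m → Fin n) → Dec (StrictMono α)
strictMono? α = all? λ x → all? λ y → (x Fin.<? y) →-dec (α x Fin.<? α y)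

trace-mono : ∀ {G K L} {P' P : Parade G K L} {S I J} →
             IsContraction P' P → InTrace P' S I J → InTrace P S I J
trace-mono (A'⊆A , B'⊆B) (c , support) =
  record { f₁ = f₁ c ; f₂ = f₂ c ; α = α c ; β = β c
         ; α-mono = α-mono c ; β-mono = β-mono c
         ; f₁∈ = λ x → A'⊆A (α c x) (f₁∈ c x)
         ; f₂∈ = λ y → B'⊆B (β c y) (f₂∈ c y)
         ; edges = edges c } , support

trace-adj-cong : ∀ {G K L} {P : Parade G K L} {a b} {f f' : Fin a → Fin b → Bool} {I J} →
                 (∀ x y → f x y ≡ f' x y) →
                 InTrace P (record { s₁ = a ; s₂ = b ; sadj = f }) I J →
                 InTrace P (record { s₁ = a ; s₂ = b ; sadj = f' }) I J
trace-adj-cong f≡f' (c , support) =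
  record { f₁ = f₁ c ; f₂ = f₂ c ; α = α c ; β = β c
         ; α-mono = α-mono c ; β-mono = β-mono c ; f₁∈ = f₁∈ c ; f₂∈ = f₂∈ c
         ; edges = λ x y → trans (edges c x y) (f≡f' x y) } , support

module _ {G : Bigraph} {K L : ℕ} (P : Parade G K L) (S : OrdBigraph) (I : Subset K) (J : Subset L) where

  private
    IsCopy : (Fin (s₁ S) → Fin (n₁ G)) → (Fin (s₂ S) → Fin (n₂ G)) →
             (Fin (s₁ S) → Fin K) → (Fin (s₂ S) → Fin L) → Set
    IsCopy f₁ f₂ α β =
      (StrictMono α × StrictMono β) ×
      ((∀ x → f₁ x ∈ A P (α x)) × (∀ y → f₂ y ∈ B P (β y))) ×
      (∀ x y → adj G (f₁ x) (f₂ y) ≡ sadj S x y) ×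
      (Image α I × Image β J)

    isCopy? : ∀ f₁ f₂ α β → Dec (IsCopy f₁ f₂ α β)
    isCopy? f₁ f₂ α β =
      (strictMono? α ×-dec strictMono? β) ×-dec
      ((all? λ x → f₁ x ∈? A P (α x)) ×-dec (all? λ y → f₂ y ∈? B P (β y))) ×-dec
      (all? λ x → all? λ y → adj G (f₁ x) (f₂ y) Bool.≟ sadj S x y) ×-dec
      (image? α I ×-dec image? β J)

    IsCopy-cong : ∀ {f₁ f₁' f₂ f₂' α α' β β'} → f₁ ≗ f₁' → f₂ ≗ f₂' → α ≗ α' → β ≗ β' →
                  IsCopy f₁ f₂ α β → IsCopy f₁' f₂' α' β'
    IsCopy-cong f₁≗ f₂≗ α≗ β≗ ((αm , βm) , (f₁∈ , f₂∈) , e , (αI , βJ)) =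
      (StrictMono-cong α≗ αm , StrictMono-cong β≗ βm) ,
      ((λ x → subst₂ (λ v i → v ∈ A P i) (f₁≗ x) (α≗ x) (f₁∈ x)) ,
       (λ y → subst₂ (λ v j → v ∈ B P j) (f₂≗ y) (β≗ y) (f₂∈ y))) ,
      (λ x y → subst₂ (λ u v → adj G u v ≡ sadj S x y) (f₁≗ x) (f₂≗ y) (e x y)) ,
      (Image-cong α≗ αI , Image-cong β≗ βJ)

    CopyData : Set
    CopyData = (Vec (Fin (n₁ G)) (s₁ S) × Vec (Fin (n₂ G)) (s₂ S)) ×
               (Vec (Fin K) (s₁ S) × Vec (Fin L) (s₂ S))

    IsCopyData : CopyData → Set
    IsCopyData ((f₁ , f₂) , (α , β)) = IsCopy (lookup f₁) (lookup f₂) (lookup α) (lookup β)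

    toTrace : ∀ d → IsCopyData d → InTrace P S I J
    toTrace ((f₁ , f₂) , (α , β)) ((αm , βm) , (f₁∈ , f₂∈) , e , support) =
      record { f₁ = lookup f₁ ; f₂ = lookup f₂ ; α = lookup α ; β = lookup β
             ; α-mono = αm ; β-mono = βm ; f₁∈ = f₁∈ ; f₂∈ = f₂∈ ; edges = e } , support

    fromTrace : InTrace P S I J → ∃ IsCopyData
    fromTrace (c , support) =
      ((tabulate (f₁ c) , tabulate (f₂ c)) , (tabulate (α c) , tabulate (β c))) ,
      IsCopy-cong (sym ∘ lookup∘tabulate (f₁ c)) (sym ∘ lookup∘tabulate (f₂ c))
                  (sym ∘ lookup∘tabulate (α c)) (sym ∘ lookup∘tabulate (β c))
                  ((α-mono c , β-mono c) , (f₁∈ c , f₂∈ c) , edges c , support)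

  inTrace? : Dec (InTrace P S I J)
  inTrace? =
    map′ (λ (d , isCopy) → toTrace d isCopy) fromTrace
         (search-× (search-× (search-Vec any? _) (search-Vec any? _))
                   (search-× (search-Vec any? _) (search-Vec any? _))
                   (λ ((f₁ , f₂) , (α , β)) → isCopy? (lookup f₁) (lookup f₂) (lookup α) (lookup β)))

StrictMono-pred : ∀ {s n} {α : Fin s → Fin (suc n)} {α' : Fin s → Fin n} →
                  (∀ x → α x ≡ suc (α' x)) → StrictMono α → StrictMono α'
StrictMono-pred α≡suc∘α' mono x y x<y =
  s<s⁻¹ (subst₂ Fin._<_ (α≡suc∘α' x) (α≡suc∘α' y) (mono x y x<y))

factor-through-suc : ∀ {s n} (α : Fin s → Fin (suc n)) → (∀ x → α x ≢ zero) →
                     Σ (Fin s → Fin n) λ α' → ∀ x → α x ≡ suc (α' x)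
factor-through-suc α α≢0 =
  (λ x → punchOut (α≢0 x ∘ sym)) , λ x → sym (Fin.punchIn-punchOut (α≢0 x ∘ sym))

Image-tail : ∀ {s n} {α : Fin s → Fin (suc n)} {α' : Fin s → Fin n} {b I} →
             (∀ x → α x ≡ suc (α' x)) → Image α (b ∷ I) → Image α' I
Image-tail {α = α} {α'} {b} {I} α≡suc∘α' im i = mk⇔ to from
  where
  to : i ∈ I → ∃[ x ] α' x ≡ i
  to i∈I with x , αx≡ ← Equivalence.to (im (suc i)) (there i∈I) =
    x , Fin.suc-injective (trans (sym (α≡suc∘α' x)) αx≡)
  from : ∃[ x ] α' x ≡ i → i ∈ I
  from (x , α'x≡i)
    with there i∈I ← Equivalence.from (im (suc i)) (x , trans (α≡suc∘α' x) (cong suc α'x≡i)) = i∈I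

∣image∣≡s : ∀ {s n} {α : Fin s → Fin n} {I} → StrictMono α → Image α I → ∣ I ∣ ≡ s
∣image∣≡s {zero}  {I = []} _ _ = refl
∣image∣≡s {suc s} {α = α} {[]} _ _ with () ← α zero
∣image∣≡s {α = α} {outside ∷ I} mono im =
  let α' , α≡suc∘α' = factor-through-suc α α≢0
  in  ∣image∣≡s (StrictMono-pred α≡suc∘α' mono) (Image-tail α≡suc∘α' im)
  where
  α≢0 : ∀ x → α x ≢ zero
  α≢0 x αx≡0 with () ← Equivalence.from (im zero) (x , αx≡0)
∣image∣≡s {zero} {I = inside ∷ I} _ im with () , _ ← Equivalence.to (im zero) here
∣image∣≡s {suc s} {α = α} {inside ∷ I} mono im =
  cong suc (∣image∣≡s {I = outside ∷ I} (λ x y x<y → mono (suc x) (suc y) (s≤s x<y)) im-tail)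
  where
  α∘suc≢0 : ∀ x → α (suc x) ≢ zero
  α∘suc≢0 x αx≡0 = ℕ.n≮0 (subst (α zero Fin.<_) αx≡0 (mono zero (suc x) (s≤s z≤n)))
  α0≡0 : α zero ≡ zero
  α0≡0 with Equivalence.to (im zero) here
  ... | zero  , α0≡0 = α0≡0
  ... | suc x , αx≡0 = ⊥-elim (α∘suc≢0 x αx≡0)
  -- α zero is the least point of the image, so removing it leaves the image of α ∘ suc.
  im-tail : Image (α ∘ suc) (outside ∷ I)
  im-tail zero = mk⇔ (λ ()) (λ (x , αx≡0) → ⊥-elim (α∘suc≢0 x αx≡0))
  im-tail (suc i) = mk⇔ to from
    where
    to : suc i ∈ outside ∷ I → ∃[ x ] α (suc x) ≡ suc i
    to (there i∈I) with Equivalence.to (im (suc i)) (there i∈I)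
    ... | zero  , α0≡ with () ← trans (sym α0≡0) α0≡
    ... | suc x , αx≡ = x , αx≡
    from : ∃[ x ] α (suc x) ≡ suc i → suc i ∈ outside ∷ I
    from (x , αx≡) with there i∈I ← Equivalence.from (im (suc i)) (suc x , αx≡) = there i∈I

support-size : ∀ {G K L} {P : Parade G K L} {S I J} → InTrace P S I J → ∣ I ∣ ≡ s₁ S × ∣ J ∣ ≡ s₂ S
support-size (c , αI , βJ) = ∣image∣≡s (α-mono c) αI , ∣image∣≡s (β-mono c) βJ

module _ {V : Set} where

  Unique-++⁻ˡ : ∀ {xs ys : List V} → Unique (xs ++ ys) → Unique xs
  Unique-++⁻ˡ {[]}     _          = []
  Unique-++⁻ˡ {x ∷ xs} (x∉ ∷ u) = All.++⁻ˡ xs x∉ ∷ Unique-++⁻ˡ u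

  Unique-reverse : ∀ {xs : List V} → Unique xs → Unique (reverse xs)
  Unique-reverse {xs} = Permutation.Unique-resp-↭ (setoid V) (↭⇒↭ₛ (↭-sym (↭-reverse xs)))

  Unique-∷ʳ⇒∉ : ∀ {xs : List V} {v} → Unique (xs ∷ʳ v) → v ∉ xs
  Unique-∷ʳ⇒∉ {x ∷ xs} (x∉ ∷ _) (Any.here refl) = All.lookup x∉ (∈-++⁺ʳ xs (Any.here refl)) refl
  Unique-∷ʳ⇒∉ {x ∷ xs} (_ ∷ u)  (Any.there v∈) = Unique-∷ʳ⇒∉ u v∈

  module _ {R : Rel V 0ℓ} where

    Linked-++⁻ˡ : ∀ {xs ys} → Linked R (xs ++ ys) → Linked R xs
    Linked-++⁻ˡ {[]}         _       = []
    Linked-++⁻ˡ {x ∷ []}     _       = [-]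
    Linked-++⁻ˡ {x ∷ y ∷ xs} (r ∷ l) = r ∷ Linked-++⁻ˡ {y ∷ xs} l

    Linked-join : ∀ xs {w ys} → Linked R (xs ∷ʳ w) → Linked R (w ∷ ys) → Linked R (xs ++ w ∷ ys)
    Linked-join []           _        l = l
    Linked-join (x ∷ [])     (r ∷ _)  l = r ∷ l
    Linked-join (x ∷ y ∷ xs) (r ∷ l₁) l₂ = r ∷ Linked-join (y ∷ xs) l₁ l₂

    module _ (R-sym : Symmetric R) where

      Linked-ʳ++ : ∀ {x} xs {ys} → Linked R (x ∷ xs) → Linked R (x ∷ ys) → Linked R (xs ʳ++ x ∷ ys)
      Linked-ʳ++ []       _        l = l
      Linked-ʳ++ (y ∷ xs) (r ∷ lx) l = Linked-ʳ++ xs lx (R-sym r ∷ l)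

      Linked-reverse : ∀ {xs} → Linked R xs → Linked R (reverse xs)
      Linked-reverse {[]}     _ = []
      Linked-reverse {x ∷ xs} l = Linked-ʳ++ xs l [-]

  module _ (_≟_ : DecidableEquality V) where

    open import Data.List.Membership.DecPropositional _≟_ using () renaming (_∈?_ to _∈ˡ?_)

    first-common : ∀ xs ys {w} → w ∈ˡ xs → w ∈ˡ ys →
                   ∃[ Y ] ∃[ v ] ∃[ Z ] ys ≡ Y ++ v ∷ Z × v ∈ˡ xs × All (_∉ xs) Y
    first-common xs (y ∷ ys) w∈xs w∈y∷ys with y ∈ˡ? xs
    ... | yes y∈xs = [] , y , ys , refl , y∈xs , []
    first-common xs (y ∷ ys) w∈xs (Any.here refl)  | no y∉xs = ⊥-elim (y∉xs w∈xs)
    first-common xs (y ∷ ys) w∈xs (Any.there w∈ys) | no y∉xs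
      with Y , v , Z , ys≡ , v∈xs , Y∉xs ← first-common xs ys w∈xs w∈ys =
      y ∷ Y , v , Z , cong (y ∷_) ys≡ , v∈xs , y∉xs ∷ Y∉xs

module _ (S : OrdBigraph) where

  Adj-sym : Symmetric (Adj S)
  Adj-sym {inj₁ _} {inj₂ _} e = e
  Adj-sym {inj₂ _} {inj₁ _} e = e

  Adj-irrefl : ∀ {u} → ¬ Adj S u u
  Adj-irrefl {inj₁ _} ()
  Adj-irrefl {inj₂ _} ()

  _≟ᵥ_ : DecidableEquality (Vtx S)
  _≟ᵥ_ = Sum.≡-dec Fin._≟_ Fin._≟_

  private
    module Walk {s v : Vtx S} (X Y : List (Vtx S)) (X∩Y=∅ : Disjoint X Y)
                (uX : Unique (s ∷ X ∷ʳ v)) (lX : Linked (Adj S) (s ∷ X ∷ʳ v))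
                (uY : Unique (s ∷ Y ∷ʳ v)) (lY : Linked (Adj S) (s ∷ Y ∷ʳ v)) where

      back≡ : reverse (Y ∷ʳ v) ≡ v ∷ reverse Y
      back≡ = reverse-++ Y [ v ]

      ∈back : ∀ {x} → x ∈ˡ v ∷ reverse Y → x ∈ˡ Y ∷ʳ v
      ∈back x∈ = reverse⁻ (subst (_ ∈ˡ_) (sym back≡) x∈)

      unique : Unique (s ∷ X ++ v ∷ reverse Y)
      unique =
        All.tabulate s∉ ∷
        Unique.++⁺ (Unique-++⁻ˡ (AllPairs.tail uX)) (subst Unique back≡ (Unique-reverse (AllPairs.tail uY))) disjoint
        where
        s∉ : ∀ {x} → x ∈ˡ X ++ v ∷ reverse Y → s ≢ x
        s∉ x∈ refl with ∈-++⁻ X x∈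
        ... | inj₁ s∈X    = All.lookup (AllPairs.head uX) (∈-++⁺ˡ s∈X) refl
        ... | inj₂ s∈back = All.lookup (AllPairs.head uY) (∈back s∈back) refl
        disjoint : Disjoint X (v ∷ reverse Y)
        disjoint (x∈X , x∈back) with ∈-++⁻ Y (∈back x∈back)
        ... | inj₁ x∈Y              = X∩Y=∅ (x∈X , x∈Y)
        ... | inj₂ (Any.here refl) = Unique-∷ʳ⇒∉ (AllPairs.tail uX) x∈X

      linked : Linked (Adj S) (s ∷ X ++ v ∷ reverse Y)
      linked = Linked-join (s ∷ X) lX (subst (Linked (Adj S)) back≡ (Linked-reverse Adj-sym (Linked.tail lY)))

  -- The cycle runs out along the first path and back along the second.
  cycle-of-two-paths : ∀ {s v} X Y → Disjoint X Y → 1 ≤ℕ length X +ℕ length Y →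
    Unique (s ∷ X ∷ʳ v) → Linked (Adj S) (s ∷ X ∷ʳ v) →
    Unique (s ∷ Y ∷ʳ v) → Linked (Adj S) (s ∷ Y ∷ʳ v) → Cycle S
  cycle-of-two-paths [] [] _ () _ _ _ _
  cycle-of-two-paths {s} {v} X@(_ ∷ _) [] X∩Y=∅ _ uX lX uY lY@(sv ∷ _) = record
    { v₁ = s ; rest = X ; vk = v ; long = s≤s z≤n
    ; distinct = Walk.unique X [] X∩Y=∅ uX lX uY lY
    ; linked = Walk.linked X [] X∩Y=∅ uX lX uY lY
    ; closing = Adj-sym sv }
  cycle-of-two-paths {s} {v} X (y ∷ Y) X∩Y=∅ _ uX lX uY lY@(sy ∷ _) = record
    { v₁ = s ; rest = X ++ v ∷ reverse Y ; vk = y ; long = nonempty X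
    ; distinct = subst (λ C → Unique (s ∷ C)) walk≡ (Walk.unique X (y ∷ Y) X∩Y=∅ uX lX uY lY)
    ; linked = subst (λ C → Linked (Adj S) (s ∷ C)) walk≡ (Walk.linked X (y ∷ Y) X∩Y=∅ uX lX uY lY)
    ; closing = Adj-sym sy }
    where
    walk≡ : X ++ v ∷ reverse (y ∷ Y) ≡ (X ++ v ∷ reverse Y) ∷ʳ y
    walk≡ = trans (cong (λ r → X ++ v ∷ r) (unfold-reverse y Y)) (sym (++-assoc X (v ∷ reverse Y) [ y ]))
    nonempty : ∀ xs → 1 ≤ℕ length (xs ++ v ∷ reverse Y)
    nonempty []      = s≤s z≤n
    nonempty (_ ∷ _) = s≤s z≤n

  cycle-of-branches : ∀ {s a b as bs w} → a ≢ b →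
    Unique (s ∷ a ∷ as) → Linked (Adj S) (s ∷ a ∷ as) →
    Unique (s ∷ b ∷ bs) → Linked (Adj S) (s ∷ b ∷ bs) →
    w ∈ˡ a ∷ as → w ∈ˡ b ∷ bs → Cycle S
  cycle-of-branches {s} {a} {b} {as} {bs} a≢b uA lA uB lB w∈A w∈B
    with Y , v , Z , B≡ , v∈A , Y∉A ← first-common _≟ᵥ_ (a ∷ as) (b ∷ bs) w∈A w∈B
    with X , Z' , A≡ ← ∈-∃++ v∈A =
    cycle-of-two-paths X Y disjoint (nontrivial X Y A≡ B≡)
      (Unique-++⁻ˡ (subst Unique (upTo A≡) uA)) (Linked-++⁻ˡ (subst (Linked (Adj S)) (upTo A≡) lA))
      (Unique-++⁻ˡ (subst Unique (upTo B≡) uB)) (Linked-++⁻ˡ (subst (Linked (Adj S)) (upTo B≡) lB))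
    where
    upTo : ∀ {xs W u U} → xs ≡ W ++ u ∷ U → s ∷ xs ≡ (s ∷ W ∷ʳ u) ++ U
    upTo {W = W} {u} {U} xs≡ = cong (s ∷_) (trans xs≡ (sym (++-assoc W [ u ] U)))
    disjoint : Disjoint X Y
    disjoint (x∈X , x∈Y) = All.lookup Y∉A x∈Y (subst (_ ∈ˡ_) (sym A≡) (∈-++⁺ˡ x∈X))
    nontrivial : ∀ X Y → a ∷ as ≡ X ++ v ∷ Z' → b ∷ bs ≡ Y ++ v ∷ Z → 1 ≤ℕ length X +ℕ length Y
    nontrivial []      []      A≡ B≡ = ⊥-elim (a≢b (trans (∷-injectiveˡ A≡) (sym (∷-injectiveˡ B≡))))
    nontrivial []      (_ ∷ _) _  _  = s≤s z≤n
    nontrivial (_ ∷ _) _       _  _  = s≤s z≤n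

module _ {S : OrdBigraph} where

  open import Data.List.Membership.DecPropositional (_≟ᵥ_ S) using () renaming (_∈?_ to _∈ᵥ?_)

  next : ∀ {u w} → Path S u w → Vtx S
  next {u} p = fromMaybe u (Data.List.head (proj₁ (Path.first p)))

  next-adjacent : ∀ {u w} (p : Path S u w) → next p ≢ u → Adj S u (next p)
  next-adjacent record { first = []    , refl }                   u↛u = ⊥-elim (u↛u refl)
  next-adjacent record { first = _ ∷ _ , refl ; linked = r ∷ _ } _   = r

  private
    chord : ∀ {u v} ru → Unique (u ∷ ru) → Linked (Adj S) (u ∷ ru) → Adj S u v →
            v ∈ˡ ru → fromMaybe u (Data.List.head ru) ≢ v → Cycle S
    chord (a ∷ as) uP lP uv v∈ru a≢v =
      cycle-of-branches S a≢v uP lP ((u≢v ∷ []) ∷ [] ∷ []) (uv ∷ [-]) v∈ru (Any.here refl)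
      where
      u≢v : _ ≢ _
      u≢v refl = Adj-irrefl S uv

    branches : ∀ {u v r} ru rv → v ∉ u ∷ ru →
               Unique (u ∷ ru) → Linked (Adj S) (u ∷ ru) → Unique (v ∷ rv) → Linked (Adj S) (v ∷ rv) →
               Adj S u v → fromMaybe v (Data.List.head rv) ≢ u → r ∈ˡ u ∷ ru → r ∈ˡ v ∷ rv → Cycle S
    branches _ _        v∉P _ _ _ _ _ _ r∈P (Any.here refl) = ⊥-elim (v∉P r∈P)
    branches ru (b ∷ bs) v∉P uP lP uQ lQ uv b≢u r∈P (Any.there r∈B) =
      cycle-of-branches S (b≢u ∘ sym) (All.¬Any⇒All¬ (_ ∷ ru) v∉P ∷ uP) (Adj-sym S uv ∷ lP) uQ lQ r∈P r∈B

    ∈-last : ∀ {xs init : List (Vtx S)} {r} → xs ≡ init ∷ʳ r → r ∈ˡ xs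
    ∈-last {init = init} xs≡ = subst (_ ∈ˡ_) (sym xs≡) (∈-++⁺ʳ init (Any.here refl))

  edge-off-paths⇒cycle : ∀ {u v r} (p : Path S u r) (q : Path S v r) →
                         Adj S u v → next p ≢ v → next q ≢ u → Cycle S
  edge-off-paths⇒cycle {u} {v}
    record { first = ru , refl ; last = _ , p≡ ; distinct = uP ; linked = lP }
    record { first = rv , refl ; last = _ , q≡ ; distinct = uQ ; linked = lQ } uv p↛v q↛u
    with v ∈ᵥ? u ∷ ru
  ... | yes (Any.here v≡u)   = ⊥-elim (Adj-irrefl S (subst (Adj S u) v≡u uv))
  ... | yes (Any.there v∈ru) = chord ru uP lP uv v∈ru p↛v
  ... | no v∉P               = branches ru rv v∉P uP lP uQ lQ uv q↛u (∈-last p≡) (∈-last q≡)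

-- Trees as parent functions

some-vertex : ∀ a b → 1 ≤ℕ a +ℕ b → Fin a ⊎ Fin b
some-vertex (suc a) b    _ = inj₁ zero
some-vertex zero (suc b) _ = inj₂ zero

ParentEdge : ∀ {A : Set} → (A → A) → A → A → Set
ParentEdge f u v = f u ≡ v ⊎ f v ≡ u

module Parent {S : OrdBigraph} (tree : IsTree S) where

  root : Vtx S
  root = some-vertex (s₁ S) (s₂ S) (proj₁ tree)

  toRoot : ∀ u → Path S u root
  toRoot u = proj₁ (proj₂ tree) u root

  parent : Vtx S → Vtx S
  parent u = next (toRoot u)

  parent-adjacent : ∀ {u v} → parent u ≡ v → u ≢ v → Adj S u v
  parent-adjacent {u} refl u≢v = next-adjacent (toRoot u) (u≢v ∘ sym)

  sadj⇔ParentEdge : ∀ x y → sadj S x y ≡ true ⇔ ParentEdge parent (inj₁ x) (inj₂ y)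
  sadj⇔ParentEdge x y = mk⇔ to from
    where
    _≟_ : DecidableEquality (Vtx S)
    _≟_ = _≟ᵥ_ S
    to : sadj S x y ≡ true → ParentEdge parent (inj₁ x) (inj₂ y)
    to xy with parent (inj₁ x) ≟ inj₂ y | parent (inj₂ y) ≟ inj₁ x
    ... | yes x↦y | _       = inj₁ x↦y
    ... | no _    | yes y↦x = inj₂ y↦x
    ... | no x↛y  | no y↛x  = ⊥-elim (proj₂ (proj₂ tree) (edge-off-paths⇒cycle (toRoot _) (toRoot _) xy x↛y y↛x))
    from : ParentEdge parent (inj₁ x) (inj₂ y) → sadj S x y ≡ true
    from (inj₁ x↦y) = parent-adjacent x↦y λ ()
    from (inj₂ y↦x) = parent-adjacent y↦x λ ()

ParentEdge-transport : ∀ {A B : Set} {h : A → A} {f : B → B} {ι : A → B} → Injective _≡_ _≡_ ι →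
                       (∀ a → f (ι a) ≡ ι (h a)) → ∀ u v → ParentEdge h u v ⇔ ParentEdge f (ι u) (ι v)
ParentEdge-transport {h = h} {f} {ι} ι-inj f∘ι≡ι∘h u v = mk⇔ to from
  where
  to : ParentEdge h u v → ParentEdge f (ι u) (ι v)
  to (inj₁ hu≡v) = inj₁ (trans (f∘ι≡ι∘h u) (cong ι hu≡v))
  to (inj₂ hv≡u) = inj₂ (trans (f∘ι≡ι∘h v) (cong ι hv≡u))
  from : ParentEdge f (ι u) (ι v) → ParentEdge h u v
  from (inj₁ fιu≡ιv) = inj₁ (ι-inj (trans (sym (f∘ι≡ι∘h u)) fιu≡ιv))
  from (inj₂ fιv≡ιu) = inj₂ (ι-inj (trans (sym (f∘ι≡ι∘h v)) fιv≡ιu))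

extend-along : ∀ {A B : Set} → Searchable A → DecidableEquality B →
               (ι : A → B) → Injective _≡_ _≡_ ι → (h : A → A) →
               Σ (B → B) λ f → ∀ a → f (ι a) ≡ ι (h a)
extend-along {B = B} search _≟_ ι ι-inj h = f , f∘ι≡ι∘h
  where
  f : B → B
  f b with search (λ a → ι a ≟ b)
  ... | yes (a , _) = ι (h a)
  ... | no _        = b
  f∘ι≡ι∘h : ∀ a → f (ι a) ≡ ι (h a)
  f∘ι≡ι∘h a with search (λ a' → ι a' ≟ ι a)
  ... | yes (a' , ιa'≡ιa) = cong (ι ∘ h) (ι-inj ιa'≡ιa)
  ... | no ∄              = ⊥-elim (∄ (a , refl))

embed : ∀ {a b τ} → .(a +ℕ b ≤ℕ τ) → Fin a ⊎ Fin b → Fin τ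
embed {a} {b} a+b≤τ u = inject≤ (join a b u) a+b≤τ

embed-injective : ∀ {a b τ} .(a+b≤τ : a +ℕ b ≤ℕ τ) → Injective _≡_ _≡_ (embed a+b≤τ)
embed-injective {a} {b} a+b≤τ {u} {v} eq = begin
  u                             ≡⟨ Fin.splitAt-join a b u ⟨
  splitAt a (join a b u)        ≡⟨ cong (splitAt a) (Fin.inject≤-injective a+b≤τ a+b≤τ _ _ eq) ⟩
  splitAt a (join a b v)        ≡⟨ Fin.splitAt-join a b v ⟩
  v                             ∎
  where open ≡-Reasoning

parentEdge? : ∀ {n} (f : Fin n → Fin n) k l → Dec (ParentEdge f k l)
parentEdge? f k l = (f k Fin.≟ l) ⊎-dec (f l Fin.≟ k)

-- A parent vector g encodes the bigraph on Fin a ⊎ Fin b (placed at the first a + b positions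
-- of Fin τ) whose edges are the pairs {k , g k}; sizes exceeding τ give the empty bigraph.
parentAdjacency : ∀ {a b τ} → Vec (Fin τ) τ → Fin a → Fin b → Bool
parentAdjacency {a} {b} {τ} g x y with a +ℕ b ≤? τ
... | yes a+b≤τ = does (parentEdge? (lookup g) (embed a+b≤τ (inj₁ x)) (embed a+b≤τ (inj₂ y)))
... | no _      = false

parentGraph : ∀ {τ} a b → Vec (Fin τ) τ → OrdBigraph
parentGraph a b g = record { s₁ = a ; s₂ = b ; sadj = parentAdjacency g }

decode : ∀ {K L} τ → Subset K → Subset L → Vec (Fin τ) τ → OrdBigraph
decode τ I J g = parentGraph ∣ I ∣ ∣ J ∣ g

tree-coding : ∀ {τ S} → IsTree S → s₁ S +ℕ s₂ S ≤ℕ τ →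
              Σ (Vec (Fin τ) τ) λ g → ∀ x y → sadj S x y ≡ parentAdjacency g x y
tree-coding {τ} {S} tree a+b≤τ = tabulate f , adjacency
  where
  open Parent tree
  ι : Vtx S → Fin τ
  ι = embed a+b≤τ
  extension : Σ (Fin τ → Fin τ) λ f → ∀ u → f (ι u) ≡ ι (parent u)
  extension = extend-along (search-⊎ any? any?) Fin._≟_ ι (embed-injective a+b≤τ) parent
  f : Fin τ → Fin τ
  f = proj₁ extension
  g∘ι≡ι∘parent : ∀ u → lookup (tabulate f) (ι u) ≡ ι (parent u)
  g∘ι≡ι∘parent u = trans (lookup∘tabulate f (ι u)) (proj₂ extension u)
  adjacency : ∀ x y → sadj S x y ≡ parentAdjacency (tabulate f) x y
  adjacency x y with s₁ S +ℕ s₂ S ≤? τ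
  ... | no a+b≰τ = ⊥-elim (a+b≰τ a+b≤τ)
  ... | yes _    = Reflects.det (Reflects.fromEquivalence (Equivalence.to adj⇔edge) (Equivalence.from adj⇔edge))
                                (proof (parentEdge? (lookup (tabulate f)) (ι (inj₁ x)) (ι (inj₂ y))))
    where
    adj⇔edge : T (sadj S x y) ⇔ ParentEdge (lookup (tabulate f)) (ι (inj₁ x)) (ι (inj₂ y))
    adj⇔edge = ⇔.trans Bool.T-≡ (⇔.trans (sadj⇔ParentEdge x y)
      (ParentEdge-transport {h = parent} {lookup (tabulate f)} {ι} (embed-injective a+b≤τ) g∘ι≡ι∘parent _ _))

tree-trace-coded : ∀ {G K L} τ {P : Parade G K L} {S I J} → IsTree S → s₁ S +ℕ s₂ S ≤ℕ τ →
                   InTrace P S I J → Σ (Vec (Fin τ) τ) λ g →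
                   ∀ (Q : Parade G K L) → InTrace Q S I J ⇔ InTrace Q (decode τ I J g) I J
tree-trace-coded τ {S = S} {I} {J} tree a+b≤τ tr = g , λ Q →
  ⇔.trans (mk⇔ (trace-adj-cong S≗g) (trace-adj-cong (λ x y → sym (S≗g x y))))
          (mk⇔ (subst (λ S' → InTrace Q S' I J) S≡) (subst (λ S' → InTrace Q S' I J) (sym S≡)))
  where
  g : Vec (Fin τ) τ
  g = proj₁ (tree-coding tree a+b≤τ)
  S≗g : ∀ x y → sadj S x y ≡ parentAdjacency g x y
  S≗g = proj₂ (tree-coding tree a+b≤τ)
  S≡ : parentGraph (s₁ S) (s₂ S) g ≡ decode τ I J g
  S≡ = cong₂ (λ a b → parentGraph a b g) (sym (proj₁ (support-size tr))) (sym (proj₂ (support-size tr)))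

module _ {A : Set} {P Q : Pred A 0ℓ} (P? : Decidable P) (Q? : Decidable Q) (Q⊆P : ∀ {a} → Q a → P a) where

  length-filter-mono : ∀ xs → length (filter Q? xs) ≤ℕ length (filter P? xs)
  length-filter-mono []       = z≤n
  length-filter-mono (x ∷ xs) with P? x | Q? x
  ... | yes _ | yes _  = s≤s (length-filter-mono xs)
  ... | yes _ | no _   = ℕ.m≤n⇒m≤1+n (length-filter-mono xs)
  ... | no ¬p | yes q  = ⊥-elim (¬p (Q⊆P q))
  ... | no _  | no _   = length-filter-mono xs

  length-filter-strict : ∀ {xs a} → a ∈ˡ xs → P a → ¬ Q a → length (filter Q? xs) <ℕ length (filter P? xs)
  length-filter-strict {x ∷ xs} (Any.here refl) p ¬q with P? x | Q? x
  ... | yes _ | yes q = ⊥-elim (¬q q)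
  ... | yes _ | no _  = s≤s (length-filter-mono xs)
  ... | no ¬p | _     = ⊥-elim (¬p p)
  length-filter-strict {x ∷ xs} (Any.there a∈xs) p ¬q with P? x | Q? x
  ... | yes _ | yes _ = s≤s (length-filter-strict a∈xs p ¬q)
  ... | yes _ | no _  = ℕ.m≤n⇒m≤1+n (length-filter-strict a∈xs p ¬q)
  ... | no ¬p | yes q = ⊥-elim (¬p (Q⊆P q))
  ... | no _  | no _  = length-filter-strict a∈xs p ¬q

module _ {A : Set} where

  vectors : List A → ∀ n → List (Vec A n)
  vectors xs zero    = [ [] ]
  vectors xs (suc n) = cartesianProductWith _∷_ xs (vectors xs n)

  ∈-vectors : ∀ {xs} → (∀ x → x ∈ˡ xs) → ∀ {n} (v : Vec A n) → v ∈ˡ vectors xs n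
  ∈-vectors all∈ []       = Any.here refl
  ∈-vectors all∈ (x ∷ v) = ∈-cartesianProductWith⁺ _∷_ (all∈ x) (∈-vectors all∈ v)

bools : List Bool
bools = false ∷ true ∷ []

∈-bools : ∀ b → b ∈ˡ bools
∈-bools false = Any.here refl
∈-bools true  = Any.there (Any.here refl)

length-cartesianProductWith : ∀ {A B C : Set} (f : A → B → C) xs ys →
  length (cartesianProductWith f xs ys) ≡ length xs *ℕ length ys
length-cartesianProductWith f []       ys = refl
length-cartesianProductWith f (x ∷ xs) ys =
  trans (length-++ (map (f x) ys)) (cong₂ _+ℕ_ (length-map (f x) ys) (length-cartesianProductWith f xs ys))

length-vectors : ∀ {A : Set} (xs : List A) n → length (vectors xs n) ≡ length xs ^ n
length-vectors xs zero    = refl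
length-vectors xs (suc n) =
  trans (length-cartesianProductWith _∷_ xs (vectors xs n)) (cong (length xs *ℕ_) (length-vectors xs n))

ℕ→ℚ-nonNeg : ∀ n → 0ℚ ≤ ℕ→ℚ n
ℕ→ℚ-nonNeg n = ℚ.nonNegative⁻¹ (ℕ→ℚ n) {{ℚ.normalize-nonNeg n 1}}

module _ {q : ℚ} (0≤q : 0ℚ ≤ q) (q≤1 : q ≤ 1ℚ) where

  open ℚ.≤-Reasoning

  private instance
    q-nonNeg : NonNegative q
    q-nonNeg = nonNegative 0≤q

  ^ℚ-nonNeg : ∀ m → 0ℚ ≤ q ^ℚ m
  ^ℚ-nonNeg zero    = ℚ.≤-trans 0≤q q≤1
  ^ℚ-nonNeg (suc m) = begin
    0ℚ          ≡⟨ ℚ.*-zeroʳ q ⟨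
    q * 0ℚ      ≤⟨ ℚ.*-monoˡ-≤-nonNeg q (^ℚ-nonNeg m) ⟩
    q * q ^ℚ m  ∎

  ^ℚ-≤1 : ∀ m → q ^ℚ m ≤ 1ℚ
  ^ℚ-≤1 zero    = ℚ.≤-refl
  ^ℚ-≤1 (suc m) = begin
    q * q ^ℚ m  ≤⟨ ℚ.*-monoˡ-≤-nonNeg q (^ℚ-≤1 m) ⟩
    q * 1ℚ      ≡⟨ ℚ.*-identityʳ q ⟩
    q           ≤⟨ q≤1 ⟩
    1ℚ          ∎

  ^ℚ-*-≤ : ∀ m {x} → 0ℚ ≤ x → q ^ℚ m * x ≤ x
  ^ℚ-*-≤ m {x} 0≤x = begin
    q ^ℚ m * x  ≤⟨ ℚ.*-monoʳ-≤-nonNeg x {{nonNegative 0≤x}} (^ℚ-≤1 m) ⟩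
    1ℚ * x      ≡⟨ ℚ.*-identityˡ x ⟩
    x           ∎

  ^ℚ-suc-*-≤ : ∀ m {x y z} → q * x ≤ y → q ^ℚ m * y ≤ z → q ^ℚ suc m * x ≤ z
  ^ℚ-suc-*-≤ m {x} {y} {z} qx≤y y≤z = begin
    (q * q ^ℚ m) * x  ≡⟨ cong (_* x) (ℚ.*-comm q (q ^ℚ m)) ⟩
    (q ^ℚ m * q) * x  ≡⟨ ℚ.*-assoc (q ^ℚ m) q x ⟩
    q ^ℚ m * (q * x)  ≤⟨ ℚ.*-monoˡ-≤-nonNeg (q ^ℚ m) {{nonNegative (^ℚ-nonNeg m)}} qx≤y ⟩
    q ^ℚ m * y        ≤⟨ y≤z ⟩
    z                 ∎

module _ {G : Bigraph} {K L : ℕ} where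

  contraction-refl : ∀ {P : Parade G K L} → IsContraction P P
  contraction-refl = (λ _ x∈ → x∈) , (λ _ y∈ → y∈)

  contraction-trans : ∀ {P₁ P₂ P₃ : Parade G K L} →
                      IsContraction P₁ P₂ → IsContraction P₂ P₃ → IsContraction P₁ P₃
  contraction-trans (A₁⊆A₂ , B₁⊆B₂) (A₂⊆A₃ , B₂⊆B₃) =
    (λ i x∈ → A₂⊆A₃ i (A₁⊆A₂ i x∈)) , (λ j y∈ → B₂⊆B₃ j (B₁⊆B₂ j y∈))

  Retains : ℚ → Parade G K L → Parade G K L → Set
  Retains q P' P = (∀ i → q * ℕ→ℚ ∣ A P i ∣ ≤ ℕ→ℚ ∣ A P' i ∣) ×
                   (∀ j → q * ℕ→ℚ ∣ B P j ∣ ≤ ℕ→ℚ ∣ B P' j ∣)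

  retains? : ∀ q P' P → Dec (Retains q P' P)
  retains? q P' P = (all? λ i → q * ℕ→ℚ ∣ A P i ∣ ℚ.≤? ℕ→ℚ ∣ A P' i ∣) ×-dec
                    (all? λ j → q * ℕ→ℚ ∣ B P j ∣ ℚ.≤? ℕ→ℚ ∣ B P' j ∣)

  retains-resp : ∀ {q P P₁ P₂} → IsContraction P₁ P₂ → IsContraction P₂ P₁ → Retains q P₁ P → Retains q P₂ P
  retains-resp (A₁⊆A₂ , B₁⊆B₂) (A₂⊆A₁ , B₂⊆B₁) (retainsA , retainsB) =
    (λ i → subst (λ X → _ ≤ ℕ→ℚ ∣ X ∣) (⊆-antisym (A₁⊆A₂ i) (A₂⊆A₁ i)) (retainsA i)) ,
    (λ j → subst (λ X → _ ≤ ℕ→ℚ ∣ X ∣) (⊆-antisym (B₁⊆B₂ j) (B₂⊆B₁ j)) (retainsB j))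

  module _ {q : ℚ} (0≤q : 0ℚ ≤ q) (q≤1 : q ≤ 1ℚ) where

    retains-^ℚ-refl : ∀ m P → Retains (q ^ℚ m) P P
    retains-^ℚ-refl m P = (λ i → ^ℚ-*-≤ 0≤q q≤1 m {ℕ→ℚ ∣ A P i ∣} (ℕ→ℚ-nonNeg ∣ A P i ∣)) ,
                          (λ j → ^ℚ-*-≤ 0≤q q≤1 m {ℕ→ℚ ∣ B P j ∣} (ℕ→ℚ-nonNeg ∣ B P j ∣))

    retains-^ℚ-trans : ∀ m {P₁ P₂ P₃} → Retains q P₂ P₁ → Retains (q ^ℚ m) P₃ P₂ → Retains (q ^ℚ suc m) P₃ P₁
    retains-^ℚ-trans m (retainsA , retainsB) (retainsA' , retainsB') =
      (λ i → ^ℚ-suc-*-≤ 0≤q q≤1 m (retainsA i) (retainsA' i)) ,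
      (λ j → ^ℚ-suc-*-≤ 0≤q q≤1 m (retainsB j) (retainsB' j))

  module _ (P : Parade G K L) where

    private
      Blocks : Set
      Blocks = Vec (Subset (n₁ G)) K × Vec (Subset (n₂ G)) L

      Contracted : Blocks → Set
      Contracted (As , Bs) =
        ((∀ i → lookup As i ⊆ A P i) × (∀ j → lookup Bs j ⊆ B P j)) ×
        ((∀ i → Nonempty (lookup As i)) × (∀ j → Nonempty (lookup Bs j))) ×
        ((∀ i i' → ∣ lookup As i ∣ ≡ ∣ lookup As i' ∣) × (∀ j j' → ∣ lookup Bs j ∣ ≡ ∣ lookup Bs j' ∣))

      contracted? : Decidable Contracted
      contracted? (As , Bs) =
        ((all? λ i → lookup As i ⊆? A P i) ×-dec (all? λ j → lookup Bs j ⊆? B P j)) ×-dec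
        ((all? λ i → nonempty? (lookup As i)) ×-dec (all? λ j → nonempty? (lookup Bs j))) ×-dec
        ((all? λ i → all? λ i' → ∣ lookup As i ∣ ℕ.≟ ∣ lookup As i' ∣) ×-dec
         (all? λ j → all? λ j' → ∣ lookup Bs j ∣ ℕ.≟ ∣ lookup Bs j' ∣))

      parade : ∀ d → Contracted d → Parade G K L
      parade (As , Bs) ((As⊆ , Bs⊆) , (As≢∅ , Bs≢∅) , (As≡ , Bs≡)) = record
        { A = lookup As ; B = lookup Bs ; A-nonempty = As≢∅ ; B-nonempty = Bs≢∅
        ; A-disjoint = λ i i' i≢i' v v∈ v∈' → A-disjoint P i i' i≢i' v (As⊆ i v∈) (As⊆ i' v∈')
        ; B-disjoint = λ j j' j≢j' v v∈ v∈' → B-disjoint P j j' j≢j' v (Bs⊆ j v∈) (Bs⊆ j' v∈')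
        ; A-equal = As≡ ; B-equal = Bs≡ }

      blocks : Parade G K L → Blocks
      blocks P'' = tabulate (A P'') , tabulate (B P'')

      blocks-contracted : ∀ {P''} → IsContraction P'' P → Contracted (blocks P'')
      blocks-contracted {P''} (A''⊆A , B''⊆B) =
        ((λ i → A''⊆A i ∘ ∈A i) , (λ j → B''⊆B j ∘ ∈B j)) ,
        ((λ i → subst Nonempty (sym (lookup∘tabulate (A P'') i)) (A-nonempty P'' i)) ,
         (λ j → subst Nonempty (sym (lookup∘tabulate (B P'') j)) (B-nonempty P'' j))) ,
        ((λ i i' → subst₂ (λ X Y → ∣ X ∣ ≡ ∣ Y ∣) (sym (lookup∘tabulate (A P'') i)) (sym (lookup∘tabulate (A P'') i')) (A-equal P'' i i')) ,
         (λ j j' → subst₂ (λ X Y → ∣ X ∣ ≡ ∣ Y ∣) (sym (lookup∘tabulate (B P'') j)) (sym (lookup∘tabulate (B P'') j')) (B-equal P'' j j')))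
        where
        ∈A : ∀ i {x} → x ∈ lookup (tabulate (A P'')) i → x ∈ A P'' i
        ∈A i {x} = subst (x ∈_) (lookup∘tabulate (A P'') i)
        ∈B : ∀ j {y} → y ∈ lookup (tabulate (B P'')) j → y ∈ B P'' j
        ∈B j {y} = subst (y ∈_) (lookup∘tabulate (B P'') j)

      blocks-equivalent : ∀ {P''} (h : Contracted (blocks P'')) →
                          IsContraction P'' (parade (blocks P'') h) × IsContraction (parade (blocks P'') h) P''
      blocks-equivalent {P''} _ =
        ((λ i {x} → subst (x ∈_) (sym (lookup∘tabulate (A P'') i))) ,
         (λ j {y} → subst (y ∈_) (sym (lookup∘tabulate (B P'') j)))) ,
        ((λ i {x} → subst (x ∈_) (lookup∘tabulate (A P'') i)) ,
         (λ j {y} → subst (y ∈_) (lookup∘tabulate (B P'') j)))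

    search-contractions : {Q : Pred (Parade G K L) 0ℓ} →
      (∀ {P₁ P₂} → IsContraction P₁ P₂ → IsContraction P₂ P₁ → Q P₁ → Q P₂) → Decidable Q →
      Dec (∃ λ P'' → IsContraction P'' P × Q P'')
    search-contractions {Q} Q-resp Q? =
      map′ to from (search-× (search-Vec anySubset? K) (search-Vec anySubset? L) valid?)
      where
      Valid : Blocks → Set
      Valid d = Σ (Contracted d) λ h → Q (parade d h)
      valid? : Decidable Valid
      valid? d with contracted? d
      ... | yes h = map′ (h ,_) (λ (h' , q) → Q-resp (same h' h) (same h h') q) (Q? (parade d h))
        where
        same : ∀ h₁ h₂ → IsContraction (parade d h₁) (parade d h₂)
        same _ _ = (λ _ x∈ → x∈) , (λ _ y∈ → y∈)
      ... | no ¬h = no (¬h ∘ proj₁)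
      to : ∃ Valid → ∃ λ P'' → IsContraction P'' P × Q P''
      to (d , h , q) = parade d h , proj₁ h , q
      from : (∃ λ P'' → IsContraction P'' P × Q P'') → ∃ Valid
      from (P'' , P''⊑P , q) =
        let h = blocks-contracted {P''} P''⊑P in
        blocks P'' , h , Q-resp (proj₁ (blocks-equivalent {P''} h)) (proj₂ (blocks-equivalent {P''} h)) q

module Iteration (τ : ℕ) {κ : ℚ} (0≤κ : 0ℚ ≤ κ) (κ≤1 : κ ≤ 1ℚ) {G : Bigraph} {K L : ℕ} where

  Code : Set
  Code = Subset K × Subset L × Vec (Fin τ) τ

  Alive : Parade G K L → Code → Set
  Alive P (I , J , g) = InTrace P (decode τ I J g) I J

  alive? : ∀ P → Decidable (Alive P)
  alive? P (I , J , g) = inTrace? P (decode τ I J g) I J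

  search-Code : Searchable Code
  search-Code = search-× anySubset? (search-× anySubset? (search-Vec any? τ))

  Violation : Parade G K L → Set
  Violation P = Σ Code λ c → Alive P c × ∃ λ P'' → IsContraction P'' P × (Retains κ P'' P × ¬ Alive P'' c)

  violation? : ∀ P → Dec (Violation P)
  violation? P = search-Code λ c →
    alive? P c ×-dec search-contractions P (resp c) (λ P'' → retains? κ P'' P ×-dec ¬? (alive? P'' c))
    where
    resp : ∀ c {P₁ P₂} → IsContraction P₁ P₂ → IsContraction P₂ P₁ →
           Retains κ P₁ P × ¬ Alive P₁ c → Retains κ P₂ P × ¬ Alive P₂ c
    resp c {P₁} {P₂} P₁⊑P₂ P₂⊑P₁ (retains , dead) =
      retains-resp {q = κ} {P} {P₁} {P₂} P₁⊑P₂ P₂⊑P₁ retains , dead ∘ trace-mono P₂⊑P₁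

  ¬violation⇒invariant : ∀ P → ¬ Violation P → SupportInvariant κ τ P
  ¬violation⇒invariant P no-violation P'' P''⊑P retainsA retainsB S tree small I J =
    mk⇔ (trace-mono P''⊑P) survives
    where
    survives : InTrace P S I J → InTrace P'' S I J
    survives tr with g , coded ← tree-trace-coded τ tree small tr with alive? P'' (I , J , g)
    ... | yes alive = Equivalence.from (coded P'') alive
    ... | no dead   =
      ⊥-elim (no-violation ((I , J , g) , Equivalence.to (coded P) tr , P'' , P''⊑P , (retainsA , retainsB) , dead))

  codes : List Code
  codes = cartesianProduct (vectors bools K) (cartesianProduct (vectors bools L) (vectors (allFin τ) τ))

  ∈-codes : ∀ c → c ∈ˡ codes
  ∈-codes (I , J , g) =
    ∈-cartesianProduct⁺ (∈-vectors ∈-bools I) (∈-cartesianProduct⁺ (∈-vectors ∈-bools J) (∈-vectors ∈-allFin g))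

  length-codes : length codes ≡ 2 ^ (K +ℕ L) *ℕ τ ^ τ
  length-codes = begin
    length codes
      ≡⟨ length-cartesianProductWith _,_ (vectors bools K) _ ⟩
    length (vectors bools K) *ℕ length (cartesianProduct (vectors bools L) (vectors (allFin τ) τ))
      ≡⟨ cong₂ _*ℕ_ (length-vectors bools K) (length-cartesianProductWith _,_ (vectors bools L) _) ⟩
    2 ^ K *ℕ (length (vectors bools L) *ℕ length (vectors (allFin τ) τ))
      ≡⟨ cong (2 ^ K *ℕ_) (cong₂ _*ℕ_ (length-vectors bools L) (length-vectors (allFin τ) τ)) ⟩
    2 ^ K *ℕ (2 ^ L *ℕ length (allFin τ) ^ τ)
      ≡⟨ cong (λ n → 2 ^ K *ℕ (2 ^ L *ℕ n ^ τ)) (length-tabulate (λ i → i)) ⟩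
    2 ^ K *ℕ (2 ^ L *ℕ τ ^ τ)
      ≡⟨ ℕ.*-assoc (2 ^ K) (2 ^ L) (τ ^ τ) ⟨
    2 ^ K *ℕ 2 ^ L *ℕ τ ^ τ
      ≡⟨ cong (_*ℕ τ ^ τ) (ℕ.^-distribˡ-+-* 2 K L) ⟨
    2 ^ (K +ℕ L) *ℕ τ ^ τ
      ∎
    where open ≡-Reasoning

  aliveCount : Parade G K L → ℕ
  aliveCount P = length (filter (alive? P) codes)

  aliveCount≤ : ∀ P → aliveCount P ≤ℕ 2 ^ (K +ℕ L) *ℕ τ ^ τ
  aliveCount≤ P = subst (aliveCount P ≤ℕ_) length-codes (length-filter (alive? P) codes)

  aliveCount-< : ∀ {P P'' c} → IsContraction P'' P → Alive P c → ¬ Alive P'' c →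
                 aliveCount P'' <ℕ aliveCount P
  aliveCount-< P''⊑P = length-filter-strict (alive? _) (alive? _) (trace-mono P''⊑P) (∈-codes _)

  Contraction : ℕ → Parade G K L → Set
  Contraction m P =
    Σ (Parade G K L) λ P' → IsContraction P' P × Retains (κ ^ℚ m) P' P × SupportInvariant κ τ P'

  -- The decision is an argument rather than a with-abstraction: abstracting over it makes
  -- Agda normalise the types in scope, which is prohibitively expensive here.
  contract : ∀ m P → aliveCount P ≤ℕ m → Dec (Violation P) → Contraction m P
  contract m P _ (no ¬violation) =
    P , contraction-refl {P = P} , retains-^ℚ-refl 0≤κ κ≤1 m P , ¬violation⇒invariant P ¬violation
  contract zero P count≤0 (yes (_ , alive , _ , P''⊑P , _ , dead)) =
    ⊥-elim (ℕ.n≮0 (ℕ.<-≤-trans (aliveCount-< P''⊑P alive dead) count≤0))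
  contract (suc m) P count≤1+m (yes (_ , alive , P'' , P''⊑P , P''-retains , dead)) =
    let count≤m = ℕ.≤-pred (ℕ.<-≤-trans (aliveCount-< P''⊑P alive dead) count≤1+m)
        P' , P'⊑P'' , P'-retains , invariant = contract m P'' count≤m (violation? P'')
    in  P' , contraction-trans {P₁ = P'} {P''} {P} P'⊑P'' P''⊑P ,
        retains-^ℚ-trans 0≤κ κ≤1 m {P} {P''} {P'} P''-retains P'-retains , invariant

mainTheorem7 : (τ : ℕ) → 1 ≤ℕ τ →
    (κ : ℚ) → 0ℚ < κ → κ ≤ 1ℚ →
    (G : Bigraph) (K L : ℕ) (P : Parade G K L) →
    Σ (Parade G K L) λ P' →
      IsContraction P' P
      × (∀ i → (κ ^ℚ ((2 ^ (K +ℕ L)) *ℕ (τ ^ τ))) * ℕ→ℚ ∣ A P i ∣ ≤ ℕ→ℚ ∣ A P' i ∣)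
      × (∀ j → (κ ^ℚ ((2 ^ (K +ℕ L)) *ℕ (τ ^ τ))) * ℕ→ℚ ∣ B P j ∣ ≤ ℕ→ℚ ∣ B P' j ∣)
      × SupportInvariant κ τ P'
-- The argument does not need 1 ≤ τ.
mainTheorem7 τ _ κ 0<κ κ≤1 G K L P =
  let P' , P'⊑P , (retainsA , retainsB) , invariant = contract _ P (aliveCount≤ P) (violation? P)
  in  P' , P'⊑P , retainsA , retainsB , invariant
  where open Iteration τ (ℚ.<⇒≤ 0<κ) κ≤1
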